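{- Let $\tau\in\mathfrak{S}_n$ and $1\leq a<b\leq n$. Let $\mathsf{S}=\tau^{ -1}([a,b])=\{s_1<\dots<s_m\}$, $\sigma=\mathrm{st}(\tau(s_1),\dots,\tau(s_m))\in\mathfrak{S}_m$, and define $\overline{\tau}^{[a,b]}\in\mathfrak{S}_n$ by $\overline{\tau}^{[a,b]}(i)=\tau(i)$ if $i\notin\mathsf{S}$ and $\overline{\tau}^{[a,b]}(s_j)=a-1+\overline{\sigma}(j)$ for $j=1,\dots,m$, where $\overline{\sigma}=\gamma(\lambda(\sigma))$. Then $\lambda(\tau)=\lambda(\overline{\tau}^{[a,b]})$.
   Context: $\mathfrak{S}_n$: permutations of $[n]$ in one-line notation; $\mathrm{st}(a_1,\dots,a_m)$ is the permutation in $\mathfrak{S}_m$ with the same relative order as the distinct integers $a_i$. For $\sigma\in\mathfrak{S}_p,\tau\in\mathfrak{S}_q$, $\sigma\vee\tau\in\mathfrak{S}_{p+q+1}$ has values $\sigma(1)+q,\dots,\sigma(p)+q,p+q+1,\tau(1),\dots,\tau(q)$. $\mathcal{Y}_n$: rooted planar binary trees with $n$ internal nodes, $\mathcal{Y}_0=\{|\}$, each $t$ ($n\ge1$) uniquely $t_l\vee t_r$ (grafting onto the two leaves of the one-node tree). $\lambda\colon\mathfrak{S}_n\to\mathcal{Y}_n$: $\lambda(\mathrm{id}_0)=|$ and $\lambda(\sigma)=\lambda(\mathrm{st}(\sigma(1),\dots,\sigma(j-1)))\vee\lambda(\mathrm{st}(\sigma(j+1),\dots,\sigma(n)))$ where $j=\sigma^{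 -1}(n)$. $\gamma\colon\mathcal{Y}_n\to\mathfrak{S}_n$: $\gamma(|)=\mathrm{id}_0$, $\gamma(t)=\gamma(t_l)\vee\gamma(t_r)$. -}

module Defs where

open import Data.Nat using (ℕ; zero; suc; _+_; _∸_; _≤_; _<_; _<?_; _≤?_; _≟_)
open import Data.List using (List; []; _∷_; _++_; map; filter; length; upTo)
open import Data.List.Relation.Binary.Permutation.Propositional using (_↭_)
open import Data.Product using (_×_; _,_)
open import Relation.Nullary using (yes; no)
open import Relation.Nullary.Decidable using (_×-dec_)

-- Permutations of [n] in one-line notation: lists that are a rearrangement
-- of 1,2,…,n.
IsPerm : ℕ → List ℕ → Set
IsPerm n xs = xs ↭ map suc (upTo n)

-- Standardisation st(a₁,…,aₘ): replace each aᵢ by 1 + #{ j | aⱼ < aᵢ }.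
-- (For distinct integers this is the permutation with the same relative order.)
st : List ℕ → List ℕ
st xs = map (λ x → suc (length (filter (_<? x) xs))) xs

data Tree : Set where
  leaf : Tree
  _∨ᵗ_ : Tree → Tree → Tree

_∨ᵖ_ : List ℕ → List ℕ → List ℕ
σ ∨ᵖ τ = map (_+ q) σ ++ (suc (p + q) ∷ τ)
  where
  p = length σ
  q = length τ

splitAtVal : ℕ → List ℕ → List ℕ × List ℕ
splitAtVal v [] = [] , []
splitAtVal v (x ∷ xs) with x ≟ v
... | yes _ = [] , xs
... | no _ with splitAtVal v xs
...   | (l , r) = x ∷ l , r

-- λ with a fuel argument (fuel = length suffices; each recursive call is on a
-- strictly shorter list).  λ(σ) = λ(st(σ(1..j-1))) ∨ λ(st(σ(j+1..n))), j = σ⁻¹(n).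
lamF : ℕ → List ℕ → Tree
lamF _ [] = leaf
lamF zero (_ ∷ _) = leaf
lamF (suc k) (x ∷ xs) with splitAtVal (length (x ∷ xs)) (x ∷ xs)
... | (l , r) = lamF k (st l) ∨ᵗ lamF k (st r)

lam : List ℕ → Tree
lam σ = lamF (length σ) σ

gam : Tree → List ℕ
gam leaf = []
gam (l ∨ᵗ r) = gam l ∨ᵖ gam r

replaceIn : ℕ → ℕ → List ℕ → List ℕ → List ℕ
replaceIn a b qs [] = []
replaceIn a b qs (x ∷ xs) with (a ≤? x) ×-dec (x ≤? b)
replaceIn a b [] (x ∷ xs) | yes _ = x ∷ replaceIn a b [] xs
replaceIn a b (q ∷ qs) (x ∷ xs) | yes _ = q ∷ replaceIn a b qs xs
... | no _ = x ∷ replaceIn a b qs xs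

-- The values τ(s₁),…,τ(sₘ) for S = τ⁻¹([a,b]), s₁<…<sₘ.
valsIn : ℕ → ℕ → List ℕ → List ℕ
valsIn a b τ = filter (λ x → (a ≤? x) ×-dec (x ≤? b)) τ

tauBar : ℕ → ℕ → List ℕ → List ℕ
tauBar a b τ = replaceIn a b (map (λ v → (a ∸ 1) + v) (gam (lam (st (valsIn a b τ))))) τ

-- λ(τ) only depends on which position carries the maximum of τ on each interval of
-- positions: the root of λ(τ) is the position of the maximum, and its subtrees are λ of
-- the parts to the left and to the right of it.  Write xs ⊑ ys when every interval argmax
-- of xs is one of ys.  Standardisation, γ∘λ and adding a constant all preserve interval
-- argmaxes, so the entries of τ lying in [a, b], read from left to right, have the same
-- interval argmaxes as the block a-1+σ̄.  Because [a, b] is an interval of values, putting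
-- this block in place of those entries keeps every interval argmax of τ, hence
-- λ(τ) = λ(τ̄^[a,b]).
{-# OPTIONS --safe #-}
module Submission where

open import Defs
open import Data.Nat using (ℕ; zero; suc; _+_; _∸_; _≤_; _<_; _<?_; _≤?_; _≟_; z≤n; s≤s; z<s)
open import Data.Nat.Properties
open import Data.List using (List; []; _∷_; _++_; map; filter; length; take; drop; applyUpTo)
open import Data.List.Properties
  using ( length-map; length-take; length-drop; length-++; length-applyUpTo; take-all; map-upTo; ++-identityʳ
        ; filter-accept; filter-reject; filter-all; filter-none; filter-++)
open import Data.List.Relation.Unary.All as All using (All; []; _∷_)
open import Data.List.Relation.Unary.All.Properties as All using ()
open import Data.List.Relation.Unary.Any using (here; there)
open import Data.List.Relation.Unary.AllPairs using (_∷_)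
open import Data.List.Relation.Unary.Unique.Propositional using (Unique)
import Data.List.Relation.Unary.Unique.Propositional.Properties as Unique
open import Data.List.Membership.Propositional using (_∈_)
open import Data.List.Membership.Propositional.Properties using (∈-applyUpTo⁺; ∈-applyUpTo⁻)
open import Data.List.Relation.Binary.Sublist.Propositional using (⊆-refl)
open import Data.List.Relation.Binary.Sublist.Propositional.Properties using (filter⁺; length-mono-≤)
open import Data.List.Relation.Binary.Permutation.Propositional
  using (_↭_; ↭-sym; ↭-trans; ↭-reflexive; ↭⇒↭ₛ)
open import Data.List.Relation.Binary.Permutation.Propositional.Properties
  using (∈-resp-↭; ↭-length; filter-↭)
open import Data.Product using (_×_; _,_; proj₁; proj₂; Σ; Σ-syntax)
open import Data.Sum as Sum using (_⊎_; inj₁; inj₂)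
open import Data.Empty using (⊥-elim)
open import Function using (_∘_)
open import Relation.Nullary using (yes; no; ¬_; Dec)
open import Relation.Nullary.Decidable using (_×-dec_)
open import Relation.Binary.Definitions using (Tri; tri<; tri≈; tri>)
open import Relation.Binary.PropositionalEquality
open import Data.List.Relation.Binary.Permutation.Setoid.Properties (setoid ℕ) using (Unique-resp-↭)

-- Total lookup: 0 out of range, so every lemma below carries its index bounds.
at : List ℕ → ℕ → ℕ
at []       _       = 0
at (x ∷ xs) zero    = x
at (x ∷ xs) (suc m) = at xs m

at-take : ∀ r xs {m} → m < r → at (take r xs) m ≡ at xs m
at-take (suc r) []       _       = refl
at-take (suc r) (x ∷ xs) {zero}  _       = refl
at-take (suc r) (x ∷ xs) {suc m} (s≤s m<r) = at-take r xs m<r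

at-drop : ∀ k xs m → at (drop k xs) m ≡ at xs (k + m)
at-drop zero    xs       m = refl
at-drop (suc k) []       m = refl
at-drop (suc k) (x ∷ xs) m = at-drop k xs m

at-map : ∀ (f : ℕ → ℕ) xs {m} → m < length xs → at (map f xs) m ≡ f (at xs m)
at-map f (x ∷ xs) {zero}  _         = refl
at-map f (x ∷ xs) {suc m} (s≤s m<) = at-map f xs m<

length-take-≤ : ∀ r (xs : List ℕ) → r ≤ length xs → length (take r xs) ≡ r
length-take-≤ r xs r≤ = trans (length-take r xs) (m≤n⇒m⊓n≡m r≤)

<-length-take : ∀ r (xs : List ℕ) {m} → m < length (take r xs) → m < r × m < length xs
<-length-take r xs m< = m<n⊓o⇒m<n r _ m<r⊓xs , m<n⊓o⇒m<o r _ m<r⊓xs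
  where m<r⊓xs = subst (_ <_) (length-take r xs) m<

≤-length-drop : ∀ k (xs : List ℕ) {j} → 0 < j → j ≤ length (drop k xs) → k + j ≤ length xs
≤-length-drop zero    xs       _   j≤ = j≤
≤-length-drop (suc k) []       (s≤s _) ()
≤-length-drop (suc k) (x ∷ xs) 0<j j≤ = s≤s (≤-length-drop k xs 0<j j≤)

length-drop-≥ : ∀ k (xs : List ℕ) {j} → k + j ≤ length xs → j ≤ length (drop k xs)
length-drop-≥ zero    xs       j≤        = j≤
length-drop-≥ (suc k) (x ∷ xs) (s≤s j≤) = length-drop-≥ k xs j≤

All-at : ∀ {P : ℕ → Set} {xs m} → All P xs → m < length xs → P (at xs m)
All-at {m = zero}  (px ∷ _)   _        = px
All-at {m = suc m} (_  ∷ pxs) (s≤s m<) = All-at pxs m<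

at-length-++ : ∀ xs {v} ys → at (xs ++ v ∷ ys) (length xs) ≡ v
at-length-++ []       ys = refl
at-length-++ (x ∷ xs) ys = at-length-++ xs ys

take-length-++ : ∀ (xs ys : List ℕ) → take (length xs) (xs ++ ys) ≡ xs
take-length-++ []       ys = refl
take-length-++ (x ∷ xs) ys = cong (x ∷_) (take-length-++ xs ys)

drop-suc-length-++ : ∀ xs {v} (ys : List ℕ) → drop (suc (length xs)) (xs ++ v ∷ ys) ≡ ys
drop-suc-length-++ []       ys = refl
drop-suc-length-++ (x ∷ xs) ys = drop-suc-length-++ xs ys

at-∈ : ∀ xs {m} → m < length xs → at xs m ∈ xs
at-∈ (x ∷ xs) {zero}  _        = here refl
at-∈ (x ∷ xs) {suc m} (s≤s m<) = there (at-∈ xs m<)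

∈-at : ∀ {x} xs → x ∈ xs → Σ[ m ∈ ℕ ] m < length xs × at xs m ≡ x
∈-at (y ∷ xs) (here refl) = 0 , z<s , refl
∈-at (y ∷ xs) (there x∈)  = let m , m< , eq = ∈-at xs x∈ in suc m , s≤s m< , eq

-- Interval argmaxes

ArgmaxOn : List ℕ → ℕ → ℕ → ℕ → Set
ArgmaxOn xs i j p = ∀ m → i ≤ m → m < j → m ≢ p → at xs m < at xs p

record _⊑_ (xs ys : List ℕ) : Set where
  field
    length≡ : length xs ≡ length ys
    argmax  : ∀ i j p → i ≤ p → p < j → j ≤ length xs → ArgmaxOn xs i j p → ArgmaxOn ys i j p
open _⊑_

IsArgmax : List ℕ → ℕ → Set
IsArgmax xs r = r < length xs × ArgmaxOn xs 0 (length xs) r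

MaxIs : ℕ → List ℕ → Set
MaxIs v xs = ∀ r → IsArgmax xs r → at xs r ≡ v

-- lamF cuts its argument at the value length xs, which is the maximum only under this invariant.
MaxIsLength : List ℕ → Set
MaxIsLength xs = MaxIs (length xs) xs

Distinct : List ℕ → Set
Distinct xs = ∀ i j → i < length xs → j < length xs → at xs i ≡ at xs j → i ≡ j

ArgmaxOn-cong : ∀ xs ys {i j p} → p < j → (∀ m → m < j → at xs m ≡ at ys m) →
  ArgmaxOn xs i j p → ArgmaxOn ys i j p
ArgmaxOn-cong xs ys p<j xs≗ys max m i≤m m<j m≢p =
  subst₂ _<_ (xs≗ys m m<j) (xs≗ys _ p<j) (max m i≤m m<j m≢p)

ArgmaxOn-drop⁺ : ∀ k xs {i j p} → ArgmaxOn xs (k + i) (k + j) (k + p) → ArgmaxOn (drop k xs) i j p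
ArgmaxOn-drop⁺ k xs {p = p} max m i≤m m<j m≢p =
  subst₂ _<_ (sym (at-drop k xs m)) (sym (at-drop k xs p))
    (max (k + m) (+-monoʳ-≤ k i≤m) (+-monoʳ-< k m<j) (m≢p ∘ +-cancelˡ-≡ k m p))

ArgmaxOn-drop⁻ : ∀ k xs {i j p} → ArgmaxOn (drop k xs) i j p → ArgmaxOn xs (k + i) (k + j) (k + p)
ArgmaxOn-drop⁻ k xs {i} {j} {p} max m' k+i≤m' m'<k+j m'≢k+p
  with m , refl ← m≤n⇒∃[o]m+o≡n (≤-trans (m≤m+n k i) k+i≤m') =
  subst₂ _<_ (at-drop k xs m) (at-drop k xs p)
    (max m (+-cancelˡ-≤ k i m k+i≤m') (+-cancelˡ-< k m j m'<k+j) (m'≢k+p ∘ cong (k +_)))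

⊑-trans : ∀ {xs ys zs} → xs ⊑ ys → ys ⊑ zs → xs ⊑ zs
⊑-trans xs⊑ys ys⊑zs = record
  { length≡ = trans (length≡ xs⊑ys) (length≡ ys⊑zs)
  ; argmax  = λ i j p i≤p p<j j≤ →
      argmax ys⊑zs i j p i≤p p<j (subst (j ≤_) (length≡ xs⊑ys) j≤)
      ∘ argmax xs⊑ys i j p i≤p p<j j≤
  }

⊑-pointwise : ∀ {xs ys} → length xs ≡ length ys →
  (∀ m m' → m < length xs → m' < length xs → at xs m < at xs m' → at ys m < at ys m') → xs ⊑ ys
⊑-pointwise length≡ mono = record
  { length≡ = length≡
  ; argmax  = λ i j p i≤p p<j j≤ max m i≤m m<j m≢p →
      mono m p (<-≤-trans m<j j≤) (<-≤-trans p<j j≤) (max m i≤m m<j m≢p)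
  }

⊑-map : ∀ (f : ℕ → ℕ) → (∀ {x y} → x < y → f x < f y) → ∀ xs → xs ⊑ map f xs
⊑-map f f-mono xs = ⊑-pointwise (sym (length-map f xs)) λ m m' m< m'< x<x' →
  subst₂ _<_ (sym (at-map f xs m<)) (sym (at-map f xs m'<)) (f-mono x<x')

map-⊑ : ∀ (f : ℕ → ℕ) → (∀ {x y} → f x < f y → x < y) → ∀ xs → map f xs ⊑ xs
map-⊑ f f-reflects xs = ⊑-pointwise (length-map f xs) λ m m' m< m'< fx<fx' →
  let m<xs  = subst (m <_) (length-map f xs) m<
      m'<xs = subst (m' <_) (length-map f xs) m'<
  in f-reflects (subst₂ _<_ (at-map f xs m<xs) (at-map f xs m'<xs) fx<fx')

take-mono-⊑ : ∀ r {xs ys} → r ≤ length xs → xs ⊑ ys → take r xs ⊑ take r ys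
take-mono-⊑ r {xs} {ys} r≤xs xs⊑ys = record
  { length≡ = trans (length-take-≤ r xs r≤xs) (sym (length-take-≤ r ys r≤ys))
  ; argmax  = λ i j p i≤p p<j j≤ max →
      let j≤r = subst (j ≤_) (length-take-≤ r xs r≤xs) j≤
          agree : ∀ zs m → m < j → at (take r zs) m ≡ at zs m
          agree zs m m<j = at-take r zs (<-≤-trans m<j j≤r)
      in ArgmaxOn-cong ys (take r ys) p<j (λ m m<j → sym (agree ys m m<j))
           (argmax xs⊑ys i j p i≤p p<j (≤-trans j≤r r≤xs)
             (ArgmaxOn-cong (take r xs) xs p<j (agree xs) max))
  }
  where
  r≤ys = subst (r ≤_) (length≡ xs⊑ys) r≤xs

drop-mono-⊑ : ∀ k {xs ys} → xs ⊑ ys → drop k xs ⊑ drop k ys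
drop-mono-⊑ k {xs} {ys} xs⊑ys = record
  { length≡ = trans (length-drop k xs) (trans (cong (_∸ k) (length≡ xs⊑ys)) (sym (length-drop k ys)))
  ; argmax  = λ i j p i≤p p<j j≤ max →
      ArgmaxOn-drop⁺ k ys (argmax xs⊑ys (k + i) (k + j) (k + p) (+-monoʳ-≤ k i≤p) (+-monoʳ-< k p<j)
        (≤-length-drop k xs (≤-<-trans z≤n p<j) j≤) (ArgmaxOn-drop⁻ k xs max))
  }

IsArgmax-unique : ∀ xs {r r'} → IsArgmax xs r → IsArgmax xs r' → r ≡ r'
IsArgmax-unique xs {r} {r'} (r< , max) (r'< , max') with r ≟ r'
... | yes r≡r' = r≡r'
... | no r≢r'  = ⊥-elim (<-asym (max r' z≤n r'< (r≢r' ∘ sym)) (max' r z≤n r< r≢r'))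

⊑-IsArgmax : ∀ {xs ys r} → xs ⊑ ys → IsArgmax xs r → IsArgmax ys r
⊑-IsArgmax {xs} {ys} {r} xs⊑ys (r< , max) =
  subst (r <_) (length≡ xs⊑ys) r< ,
  subst (λ L → ArgmaxOn ys 0 L r) (length≡ xs⊑ys) (argmax xs⊑ys 0 (length xs) r z≤n r< ≤-refl max)

length-around : ∀ r (xs : List ℕ) → r < length xs → length xs ≡ suc r + length (drop (suc r) xs)
length-around r xs r< = trans (sym (m+[n∸m]≡n r<)) (cong (suc r +_) (sym (length-drop (suc r) xs)))

-- An interval of positions lies left of r, right of r, or contains r and then has argmax r.
⊑-split : ∀ r {xs ys} → IsArgmax xs r → IsArgmax ys r →
  take r xs ⊑ take r ys → drop (suc r) xs ⊑ drop (suc r) ys → xs ⊑ ys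
⊑-split r {xs} {ys} (r<xs , max-xs) (r<ys , max-ys) left right = record
  { length≡ = lengths ; argmax = argmax-split }
  where
  lengths : length xs ≡ length ys
  lengths = trans (length-around r xs r<xs)
              (trans (cong (suc r +_) (length≡ right)) (sym (length-around r ys r<ys)))

  argmax-split : ∀ i j p → i ≤ p → p < j → j ≤ length xs → ArgmaxOn xs i j p → ArgmaxOn ys i j p
  argmax-split i j p i≤p p<j j≤ max with r <? i
  ... | yes r<i
    with i₀ , refl ← m≤n⇒∃[o]m+o≡n r<i
       | p₀ , refl ← m≤n⇒∃[o]m+o≡n (≤-trans r<i i≤p)
       | j₀ , refl ← m≤n⇒∃[o]m+o≡n (≤-trans r<i (<⇒≤ (≤-<-trans i≤p p<j))) =
    ArgmaxOn-drop⁻ (suc r) ys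
      (argmax right i₀ j₀ p₀ (+-cancelˡ-≤ (suc r) i₀ p₀ i≤p) (+-cancelˡ-< (suc r) p₀ j₀ p<j)
        (length-drop-≥ (suc r) xs j≤) (ArgmaxOn-drop⁺ (suc r) xs max))
  argmax-split i j p i≤p p<j j≤ max | no r≮i with j ≤? r
  ... | yes j≤r =
    let agree : ∀ zs m → m < j → at (take r zs) m ≡ at zs m
        agree zs m m<j = at-take r zs (<-≤-trans m<j j≤r)
    in ArgmaxOn-cong (take r ys) ys p<j (agree ys)
         (argmax left i j p i≤p p<j (subst (j ≤_) (sym (length-take-≤ r xs (<⇒≤ r<xs))) j≤r)
           (ArgmaxOn-cong xs (take r xs) p<j (λ m m<j → sym (agree xs m m<j)) max))
  ... | no j≰r with p ≟ r
  ...   | yes refl = λ m _ m<j → max-ys m z≤n (<-≤-trans m<j (subst (j ≤_) lengths j≤))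
  ...   | no p≢r   =
    ⊥-elim (<-asym (max r (≮⇒≥ r≮i) (≰⇒> j≰r) (p≢r ∘ sym)) (max-xs p z≤n (<-≤-trans p<j j≤) p≢r))

Distinct-take : ∀ r xs → Distinct xs → Distinct (take r xs)
Distinct-take r xs distinct i j i< j< eq =
  let i<r , i<xs = <-length-take r xs i<
      j<r , j<xs = <-length-take r xs j<
  in distinct i j i<xs j<xs (trans (sym (at-take r xs i<r)) (trans eq (at-take r xs j<r)))

Distinct-drop : ∀ k xs → Distinct xs → Distinct (drop k xs)
Distinct-drop k xs distinct i j i< j< eq =
  +-cancelˡ-≡ k i j
    (distinct (k + i) (k + j) (shift i i<) (shift j j<)
      (trans (sym (at-drop k xs i)) (trans eq (at-drop k xs j))))
  where
  shift : ∀ i → i < length (drop k xs) → k + i < length xs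
  shift i i< = subst (_≤ length xs) (+-suc k i) (≤-length-drop k xs z<s i<)

IsArgmax-exists : ∀ xs → Distinct xs → 0 < length xs → Σ ℕ (IsArgmax xs)
IsArgmax-exists (z ∷ []) _ _ = 0 , z<s , λ m _ m<1 m≢0 → ⊥-elim (m≢0 (n<1⇒n≡0 m<1))
IsArgmax-exists (z ∷ w ∷ ws) distinct _
  with r , r< , max ← IsArgmax-exists (w ∷ ws) (Distinct-drop 1 (z ∷ w ∷ ws) distinct) z<s
  with <-cmp z (at (w ∷ ws) r)
... | tri< z<max _ _ = suc r , s≤s r< , argmax-tail
  where
  argmax-tail : ArgmaxOn (z ∷ w ∷ ws) 0 (length (z ∷ w ∷ ws)) (suc r)
  argmax-tail zero    _ _        _   = z<max
  argmax-tail (suc m) _ (s≤s m<) m≢r = max m z≤n m< (m≢r ∘ cong suc)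
... | tri≈ _ z≡max _ = ⊥-elim (0≢1+n (distinct 0 (suc r) z<s (s≤s r<) z≡max))
... | tri> _ _ max<z = 0 , z<s , argmax-head
  where
  argmax-head : ArgmaxOn (z ∷ w ∷ ws) 0 (length (z ∷ w ∷ ws)) 0
  argmax-head zero    _ _        m≢0 = ⊥-elim (m≢0 refl)
  argmax-head (suc m) _ (s≤s m<) _ with m ≟ r
  ... | yes refl = max<z
  ... | no m≢r   = <-trans (max m z≤n m< m≢r) max<z

IsArgmax-++ : ∀ xs {v} ys → All (_< v) xs → All (_< v) ys → IsArgmax (xs ++ v ∷ ys) (length xs)
IsArgmax-++ [] ys _ ys<v = z<s , argmax-head
  where
  argmax-head : ArgmaxOn (_ ∷ ys) 0 (suc (length ys)) 0
  argmax-head zero    _ _        m≢0 = ⊥-elim (m≢0 refl)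
  argmax-head (suc m) _ (s≤s m<) _   = All-at ys<v m<
IsArgmax-++ (x ∷ xs) {v} ys (x<v ∷ xs<v) ys<v
  with r< , max ← IsArgmax-++ xs ys xs<v ys<v = s≤s r< , argmax-later
  where
  argmax-later : ArgmaxOn (x ∷ xs ++ v ∷ ys) 0 (length (x ∷ xs ++ v ∷ ys)) (suc (length xs))
  argmax-later zero    _ _        _    = subst (x <_) (sym (at-length-++ xs ys)) x<v
  argmax-later (suc m) _ (s≤s m<) m≢r = max m z≤n m< (m≢r ∘ cong suc)

-- Standardisation

countBelow : List ℕ → ℕ → ℕ
countBelow xs x = length (filter (_<? x) xs)

countBelow-∷-< : ∀ {z} zs {x} → z < x → countBelow (z ∷ zs) x ≡ suc (countBelow zs x)
countBelow-∷-< zs {x} z<x = cong length (filter-accept (_<? x) z<x)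

countBelow-∷-≮ : ∀ {z} zs {x} → ¬ z < x → countBelow (z ∷ zs) x ≡ countBelow zs x
countBelow-∷-≮ zs {x} z≮x = cong length (filter-reject (_<? x) z≮x)

countBelow-mono : ∀ xs {x y} → x ≤ y → countBelow xs x ≤ countBelow xs y
countBelow-mono xs {x} {y} x≤y =
  length-mono-≤ (filter⁺ (_<? x) (_<? y) (λ { refl z<x → <-≤-trans z<x x≤y }) (⊆-refl {x = xs}))

countBelow-strict : ∀ xs {m y} → m < length xs → at xs m < y →
  countBelow xs (at xs m) < countBelow xs y
countBelow-strict (z ∷ zs) {zero} _ z<y =
  subst₂ _<_ (sym (countBelow-∷-≮ zs (<-irrefl refl))) (sym (countBelow-∷-< zs z<y))
    (s≤s (countBelow-mono zs (<⇒≤ z<y)))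
countBelow-strict (z ∷ zs) {suc m} {y} (s≤s m<) x<y with z <? at zs m | z <? y
... | yes z<x | yes z<y = subst₂ _<_ (sym (countBelow-∷-< zs z<x)) (sym (countBelow-∷-< zs z<y))
                            (s≤s (countBelow-strict zs m< x<y))
... | no z≮x  | no z≮y  = subst₂ _<_ (sym (countBelow-∷-≮ zs z≮x)) (sym (countBelow-∷-≮ zs z≮y))
                            (countBelow-strict zs m< x<y)
... | no z≮x  | yes z<y = subst₂ _<_ (sym (countBelow-∷-≮ zs z≮x)) (sym (countBelow-∷-< zs z<y))
                            (m<n⇒m<1+n (countBelow-strict zs m< x<y))
... | yes z<x | no z≮y  = ⊥-elim (z≮y (<-trans z<x x<y))

countBelow-reflects : ∀ xs {m m'} → m < length xs → m' < length xs →
  countBelow xs (at xs m) < countBelow xs (at xs m') → at xs m < at xs m'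
countBelow-reflects xs {m} {m'} m< m'< c<c' with <-cmp (at xs m) (at xs m')
... | tri< x<x' _ _ = x<x'
... | tri≈ _ x≡x' _ = ⊥-elim (<-irrefl (cong (countBelow xs) x≡x') c<c')
... | tri> _ _ x'<x = ⊥-elim (<-asym c<c' (countBelow-strict xs m'< x'<x))

countBelow-above-all : ∀ xs {v} → (∀ m → m < length xs → at xs m < v) → countBelow xs v ≡ length xs
countBelow-above-all []       _     = refl
countBelow-above-all (z ∷ zs) below =
  trans (countBelow-∷-< zs (below 0 z<s)) (cong suc (countBelow-above-all zs (λ m → below (suc m) ∘ s≤s)))

countBelow-argmax : ∀ xs {r} → IsArgmax xs r → suc (countBelow xs (at xs r)) ≡ length xs
countBelow-argmax (z ∷ zs) {zero} (_ , max) =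
  cong suc (trans (countBelow-∷-≮ zs (<-irrefl refl))
    (countBelow-above-all zs (λ m m< → max (suc m) z≤n (s≤s m<) λ ())))
countBelow-argmax (z ∷ zs) {suc r} (s≤s r< , max) =
  cong suc (trans (countBelow-∷-< zs (max 0 z≤n z<s λ ()))
    (countBelow-argmax zs (r< , λ m _ m< m≢r → max (suc m) z≤n (s≤s m<) (m≢r ∘ suc-injective))))

length-st : ∀ xs → length (st xs) ≡ length xs
length-st xs = length-map _ xs

at-st : ∀ xs {m} → m < length xs → at (st xs) m ≡ suc (countBelow xs (at xs m))
at-st xs = at-map (λ x → suc (countBelow xs x)) xs

st-preserves-< : ∀ xs {m m'} → m < length xs → m' < length xs →
  at xs m < at xs m' → at (st xs) m < at (st xs) m'
st-preserves-< xs m< m'< x<x' =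
  subst₂ _<_ (sym (at-st xs m<)) (sym (at-st xs m'<)) (s≤s (countBelow-strict xs m< x<x'))

⊑-st : ∀ xs → xs ⊑ st xs
⊑-st xs = ⊑-pointwise (sym (length-st xs)) (λ m m' → st-preserves-< xs)

st-⊑ : ∀ xs → st xs ⊑ xs
st-⊑ xs = ⊑-pointwise (length-st xs) λ m m' m< m'< s<s' →
  let m<xs  = subst (m <_) (length-st xs) m<
      m'<xs = subst (m' <_) (length-st xs) m'<
  in countBelow-reflects xs m<xs m'<xs (≤-pred (subst₂ _<_ (at-st xs m<xs) (at-st xs m'<xs) s<s'))

st-mono-⊑ : ∀ {xs ys} → xs ⊑ ys → st xs ⊑ st ys
st-mono-⊑ {xs} {ys} xs⊑ys = ⊑-trans (st-⊑ xs) (⊑-trans xs⊑ys (⊑-st ys))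

Distinct-st : ∀ xs → Distinct xs → Distinct (st xs)
Distinct-st xs distinct i j i< j< s≡s' = by-cases (<-cmp (at xs i) (at xs j))
  where
  i<xs = subst (i <_) (length-st xs) i<
  j<xs = subst (j <_) (length-st xs) j<
  by-cases : Tri (at xs i < at xs j) (at xs i ≡ at xs j) (at xs j < at xs i) → i ≡ j
  by-cases (tri< x<x' _ _) = ⊥-elim (<-irrefl s≡s' (st-preserves-< xs i<xs j<xs x<x'))
  by-cases (tri≈ _ x≡x' _) = distinct i j i<xs j<xs x≡x'
  by-cases (tri> _ _ x'<x) = ⊥-elim (<-irrefl (sym s≡s') (st-preserves-< xs j<xs i<xs x'<x))

MaxIsLength-st : ∀ xs → MaxIsLength (st xs)
MaxIsLength-st xs r argmax-st =
  trans (at-st xs r<xs) (trans (countBelow-argmax xs argmax-xs) (sym (length-st xs)))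
  where
  argmax-xs = ⊑-IsArgmax (st-⊑ xs) argmax-st
  r<xs = proj₁ argmax-xs

splitAtVal-first : ∀ v xs {r} → r < length xs → at xs r ≡ v → (∀ m → m < r → at xs m ≢ v) →
  splitAtVal v xs ≡ (take r xs , drop (suc r) xs)
splitAtVal-first v (x ∷ xs) {r} r< at≡v earlier≢v with x ≟ v | r
... | yes _   | zero  = refl
... | yes x≡v | suc _ = ⊥-elim (earlier≢v 0 z<s x≡v)
... | no x≢v  | zero  = ⊥-elim (x≢v at≡v)
... | no _    | suc r
  rewrite splitAtVal-first v xs (≤-pred r<) at≡v (λ m → earlier≢v (suc m) ∘ s≤s) = refl

lamF-argmax : ∀ k xs {r} → IsArgmax xs r → MaxIsLength xs →
  lamF (suc k) xs ≡ lamF k (st (take r xs)) ∨ᵗ lamF k (st (drop (suc r) xs))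
lamF-argmax k (x ∷ xs) {r} argmax@(r< , max) maxIsLength
  rewrite splitAtVal-first (length (x ∷ xs)) (x ∷ xs) r< (maxIsLength r argmax)
            (λ m m<r m≡max → <-irrefl (trans m≡max (sym (maxIsLength r argmax)))
                                      (max m z≤n (<-trans m<r r<) (<⇒≢ m<r))) = refl

length-st-take : ∀ r xs {k} → r < length xs → length xs ≤ suc k → length (st (take r xs)) ≤ k
length-st-take r xs r< xs≤ =
  subst (_≤ _) (sym (trans (length-st (take r xs)) (length-take-≤ r xs (<⇒≤ r<))))
    (≤-pred (<-≤-trans r< xs≤))

length-st-drop : ∀ r xs {k} → length xs ≤ suc k → length (st (drop (suc r) xs)) ≤ k
length-st-drop r []       _          = z≤n
length-st-drop r (x ∷ xs) (s≤s xs≤) =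
  subst (_≤ _) (sym (trans (length-st (drop r xs)) (length-drop r xs))) (≤-trans (m∸n≤m (length xs) r) xs≤)

lamF-resp-⊑ : ∀ k k' {xs ys} → length xs ≤ k → length ys ≤ k' →
  Distinct xs → MaxIsLength xs → MaxIsLength ys → xs ⊑ ys → lamF k xs ≡ lamF k' ys
lamF-resp-⊑ _ _ {[]}    {[]}    _ _ _ _ _ _ = refl
lamF-resp-⊑ _ _ {[]}    {_ ∷ _} _ _ _ _ _ xs⊑ys = ⊥-elim (0≢1+n (length≡ xs⊑ys))
lamF-resp-⊑ _ _ {_ ∷ _} {[]}    _ _ _ _ _ xs⊑ys = ⊥-elim (0≢1+n (sym (length≡ xs⊑ys)))
lamF-resp-⊑ zero _ {_ ∷ _} {_ ∷ _} () _ _ _ _ _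
lamF-resp-⊑ (suc k) zero {_ ∷ _} {_ ∷ _} _ () _ _ _ _
lamF-resp-⊑ (suc k) (suc k') {xs@(_ ∷ _)} {ys@(_ ∷ _)} xs≤ ys≤ distinct xs-max ys-max xs⊑ys
  with r , argmax-xs@(r<xs , _) ← IsArgmax-exists xs distinct z<s =
  begin
    lamF (suc k) xs
  ≡⟨ lamF-argmax k xs argmax-xs xs-max ⟩
    lamF k (st (take r xs)) ∨ᵗ lamF k (st (drop (suc r) xs))
  ≡⟨ cong₂ _∨ᵗ_ left right ⟩
    lamF k' (st (take r ys)) ∨ᵗ lamF k' (st (drop (suc r) ys))
  ≡⟨ lamF-argmax k' ys argmax-ys ys-max ⟨
    lamF (suc k') ys
  ∎
  where
  open ≡-Reasoning
  argmax-ys = ⊑-IsArgmax xs⊑ys argmax-xs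
  r<ys = proj₁ argmax-ys
  left = lamF-resp-⊑ k k' (length-st-take r xs r<xs xs≤) (length-st-take r ys r<ys ys≤)
           (Distinct-st (take r xs) (Distinct-take r xs distinct))
           (MaxIsLength-st (take r xs)) (MaxIsLength-st (take r ys))
           (st-mono-⊑ (take-mono-⊑ r (<⇒≤ r<xs) xs⊑ys))
  right = lamF-resp-⊑ k k' (length-st-drop r xs xs≤) (length-st-drop r ys ys≤)
            (Distinct-st (drop (suc r) xs) (Distinct-drop (suc r) xs distinct))
            (MaxIsLength-st (drop (suc r) xs)) (MaxIsLength-st (drop (suc r) ys))
            (st-mono-⊑ (drop-mono-⊑ (suc r) xs⊑ys))

module _ (A B : List ℕ) where
  private
    q = length B

  length-∨ᵖ : length (A ∨ᵖ B) ≡ length A + suc q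
  length-∨ᵖ = trans (length-++ (map (_+ q) A)) (cong (_+ suc q) (length-map (_+ q) A))

  at-∨ᵖ-root : at (A ∨ᵖ B) (length A) ≡ suc (length A + q)
  at-∨ᵖ-root =
    subst (λ r → at (A ∨ᵖ B) r ≡ suc (length A + q)) (length-map (_+ q) A) (at-length-++ (map (_+ q) A) B)

  take-∨ᵖ : ∀ {r} → length A ≡ r → take r (A ∨ᵖ B) ≡ map (_+ q) A
  take-∨ᵖ refl =
    subst (λ r → take r (A ∨ᵖ B) ≡ map (_+ q) A) (length-map (_+ q) A) (take-length-++ (map (_+ q) A) _)

  drop-∨ᵖ : ∀ {r} → length A ≡ r → drop (suc r) (A ∨ᵖ B) ≡ B
  drop-∨ᵖ refl =
    subst (λ r → drop (suc r) (A ∨ᵖ B) ≡ B) (length-map (_+ q) A) (drop-suc-length-++ (map (_+ q) A) B)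

  IsArgmax-∨ᵖ : All (_≤ length A) A → All (_≤ q) B → IsArgmax (A ∨ᵖ B) (length A)
  IsArgmax-∨ᵖ A≤ B≤ = subst (IsArgmax (A ∨ᵖ B)) (length-map (_+ q) A)
    (IsArgmax-++ (map (_+ q) A) B
      (All.map⁺ (All.map (λ v≤p → s≤s (+-monoˡ-≤ q v≤p)) A≤))
      (All.map (λ v≤q → s≤s (≤-trans v≤q (m≤n+m q (length A)))) B≤))

gam-bounded : ∀ t → All (λ v → 0 < v × v ≤ length (gam t)) (gam t)
gam-bounded leaf     = []
gam-bounded (l ∨ᵗ r) =
  All.++⁺ (All.map⁺ (All.map shift-left (gam-bounded l)))
          ((z<s , ≤-reflexive (sym (trans len (+-suc p q)))) ∷ All.map shift-right (gam-bounded r))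
  where
  p = length (gam l)
  q = length (gam r)
  len = length-∨ᵖ (gam l) (gam r)
  shift-left : ∀ {v} → 0 < v × v ≤ p → 0 < v + q × v + q ≤ length (gam (l ∨ᵗ r))
  shift-left {v} (0<v , v≤p) =
    <-≤-trans 0<v (m≤m+n _ q) , subst (v + q ≤_) (sym len) (+-mono-≤ v≤p (n≤1+n q))
  shift-right : ∀ {v} → 0 < v × v ≤ q → 0 < v × v ≤ length (gam (l ∨ᵗ r))
  shift-right {v} (0<v , v≤q) =
    0<v , subst (v ≤_) (sym len) (≤-trans v≤q (≤-trans (n≤1+n q) (m≤n+m (suc q) p)))

IsArgmax-gam : ∀ l r → IsArgmax (gam (l ∨ᵗ r)) (length (gam l))
IsArgmax-gam l r =
  IsArgmax-∨ᵖ (gam l) (gam r) (All.map proj₂ (gam-bounded l)) (All.map proj₂ (gam-bounded r))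

MaxIsLength-gam : ∀ t → MaxIsLength (gam t)
MaxIsLength-gam leaf     _ (() , _)
MaxIsLength-gam (l ∨ᵗ r) _ argmax
  with refl ← IsArgmax-unique (gam (l ∨ᵗ r)) (IsArgmax-gam l r) argmax =
  trans (at-∨ᵖ-root (gam l) (gam r)) (trans (sym (+-suc _ _)) (sym (length-∨ᵖ (gam l) (gam r))))

⊑-gam-lamF : ∀ k {xs} → length xs ≤ k → Distinct xs → MaxIsLength xs → xs ⊑ gam (lamF k xs)
⊑-gam-lamF _ {[]} _ _ _ = record
  { length≡ = refl ; argmax = λ _ _ _ _ p<j j≤0 → ⊥-elim (n≮0 (<-≤-trans p<j j≤0)) }
⊑-gam-lamF zero    {_ ∷ _} () _ _
⊑-gam-lamF (suc k) {xs@(_ ∷ _)} xs≤ distinct xs-max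
  with r , argmax-xs@(r<xs , _) ← IsArgmax-exists xs distinct z<s =
  subst (xs ⊑_) (cong gam (sym (lamF-argmax k xs argmax-xs xs-max)))
    (⊑-split r argmax-xs argmax-gam left right)
  where
  L = st (take r xs)
  R = st (drop (suc r) xs)
  A = gam (lamF k L)
  B = gam (lamF k R)
  L⊑A = ⊑-gam-lamF k (length-st-take r xs r<xs xs≤)
          (Distinct-st (take r xs) (Distinct-take r xs distinct)) (MaxIsLength-st (take r xs))
  R⊑B = ⊑-gam-lamF k (length-st-drop r xs xs≤)
          (Distinct-st (drop (suc r) xs) (Distinct-drop (suc r) xs distinct)) (MaxIsLength-st (drop (suc r) xs))
  length-A : length A ≡ r
  length-A = trans (sym (length≡ L⊑A)) (trans (length-st (take r xs)) (length-take-≤ r xs (<⇒≤ r<xs)))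
  argmax-gam : IsArgmax (A ∨ᵖ B) r
  argmax-gam = subst (IsArgmax (A ∨ᵖ B)) length-A (IsArgmax-gam (lamF k L) (lamF k R))
  left : take r xs ⊑ take r (A ∨ᵖ B)
  left = subst (take r xs ⊑_) (sym (take-∨ᵖ A B length-A))
           (⊑-trans (⊑-st (take r xs)) (⊑-trans L⊑A (⊑-map (_+ length B) (+-monoˡ-< (length B)) A)))
  right : drop (suc r) xs ⊑ drop (suc r) (A ∨ᵖ B)
  right = subst (drop (suc r) xs ⊑_) (sym (drop-∨ᵖ A B length-A))
            (⊑-trans (⊑-st (drop (suc r) xs)) R⊑B)

-- tauBar a b τ is replaceIn a b (relabel (a ∸ 1) (valsIn a b τ)) τ by definition.
relabel : ℕ → List ℕ → List ℕ
relabel c vs = map (c +_) (gam (lam (st vs)))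

module _ (c : ℕ) (vs : List ℕ) (distinct : Distinct vs) where
  private
    σ̄ = gam (lam (st vs))

    st⊑σ̄ : st vs ⊑ σ̄
    st⊑σ̄ = ⊑-gam-lamF (length (st vs)) ≤-refl (Distinct-st vs distinct) (MaxIsLength-st vs)

    length-σ̄ : length σ̄ ≡ length vs
    length-σ̄ = trans (sym (length≡ st⊑σ̄)) (length-st vs)

  ⊑-relabel : vs ⊑ relabel c vs
  ⊑-relabel = ⊑-trans (⊑-st vs) (⊑-trans st⊑σ̄ (⊑-map (c +_) (+-monoʳ-< c) σ̄))

  relabel-bounded : All (λ v → c < v × v ≤ c + length vs) (relabel c vs)
  relabel-bounded = All.map⁺ (All.map shift (gam-bounded (lam (st vs))))
    where
    shift : ∀ {v} → 0 < v × v ≤ length σ̄ → c < c + v × c + v ≤ c + length vs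
    shift {v} (0<v , v≤) =
      subst (_< c + v) (+-identityʳ c) (+-monoʳ-< c 0<v) , +-monoʳ-≤ c (subst (v ≤_) length-σ̄ v≤)

  MaxIs-relabel : MaxIs (c + length vs) (relabel c vs)
  MaxIs-relabel r argmax =
    trans (at-map (c +_) σ̄ (proj₁ argmax-σ̄))
      (cong (c +_) (trans (MaxIsLength-gam (lam (st vs)) r argmax-σ̄) length-σ̄))
    where
    argmax-σ̄ = ⊑-IsArgmax (map-⊑ (c +_) (+-cancelˡ-< c _ _) σ̄) argmax

-- Replacing the entries with values in [a, b]

module Replacement (a b : ℕ) where

  InRange : ℕ → Set
  InRange x = a ≤ x × x ≤ b

  inRange? : ∀ x → Dec (InRange x)
  inRange? x = (a ≤? x) ×-dec (x ≤? b)

  -- The index in valsIn a b xs of the entry at position m of xs, when that entry is in range.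
  rank : List ℕ → ℕ → ℕ
  rank xs m = length (valsIn a b (take m xs))

  length-replaceIn : ∀ qs xs → length (replaceIn a b qs xs) ≡ length xs
  length-replaceIn qs       []       = refl
  length-replaceIn []       (x ∷ xs) with inRange? x
  ... | yes _ = cong suc (length-replaceIn [] xs)
  ... | no  _ = cong suc (length-replaceIn [] xs)
  length-replaceIn (q ∷ qs) (x ∷ xs) with inRange? x
  ... | yes _ = cong suc (length-replaceIn qs xs)
  ... | no  _ = cong suc (length-replaceIn (q ∷ qs) xs)

  valsIn-∷-in : ∀ {x} xs → InRange x → valsIn a b (x ∷ xs) ≡ x ∷ valsIn a b xs
  valsIn-∷-in xs = filter-accept inRange?

  valsIn-∷-out : ∀ {x} xs → ¬ InRange x → valsIn a b (x ∷ xs) ≡ valsIn a b xs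
  valsIn-∷-out xs = filter-reject inRange?

  rank-∷-in : ∀ {x} xs m → InRange x → rank (x ∷ xs) (suc m) ≡ suc (rank xs m)
  rank-∷-in xs m = cong length ∘ valsIn-∷-in (take m xs)

  rank-∷-out : ∀ {x} xs m → ¬ InRange x → rank (x ∷ xs) (suc m) ≡ rank xs m
  rank-∷-out xs m = cong length ∘ valsIn-∷-out (take m xs)

  rank-length : ∀ xs → rank xs (length xs) ≡ length (valsIn a b xs)
  rank-length xs = cong (length ∘ valsIn a b) (take-all (length xs) xs ≤-refl)

  rank-mono : ∀ xs {m m'} → m ≤ m' → rank xs m ≤ rank xs m'
  rank-mono xs       {zero}              _          = z≤n
  rank-mono []       {suc m} {suc m'}    _          = z≤n
  rank-mono (x ∷ xs) {suc m} {suc m'}    (s≤s m≤m') with inRange? x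
  ... | yes x∈ rewrite rank-∷-in xs m x∈ | rank-∷-in xs m' x∈ = s≤s (rank-mono xs m≤m')
  ... | no  x∉ rewrite rank-∷-out xs m x∉ | rank-∷-out xs m' x∉ = rank-mono xs m≤m'

  rank-strict : ∀ xs {m m'} → m < m' → m < length xs → InRange (at xs m) → rank xs m < rank xs m'
  rank-strict (x ∷ xs) {zero}  {suc m'} _          _        x∈ rewrite rank-∷-in xs m' x∈ = z<s
  rank-strict (x ∷ xs) {suc m} {suc m'} (s≤s m<m') (s≤s m<) m∈ with inRange? x
  ... | yes x∈ rewrite rank-∷-in xs m x∈ | rank-∷-in xs m' x∈ = s≤s (rank-strict xs m<m' m< m∈)
  ... | no  x∉ rewrite rank-∷-out xs m x∉ | rank-∷-out xs m' x∉ = rank-strict xs m<m' m< m∈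

  rank≤length-valsIn : ∀ xs m → rank xs m ≤ length (valsIn a b xs)
  rank≤length-valsIn xs m with m ≤? length xs
  ... | yes m≤ = subst (rank xs m ≤_) (rank-length xs) (rank-mono xs m≤)
  ... | no  m≰ = ≤-reflexive (cong (length ∘ valsIn a b) (take-all m xs (<⇒≤ (≰⇒> m≰))))

  rank<length-valsIn : ∀ xs {m} → m < length xs → InRange (at xs m) → rank xs m < length (valsIn a b xs)
  rank<length-valsIn xs {m} m< m∈ =
    <-≤-trans (rank-strict xs (n<1+n m) m< m∈) (rank≤length-valsIn xs (suc m))

  at-valsIn-rank : ∀ xs {m} → m < length xs → InRange (at xs m) → at (valsIn a b xs) (rank xs m) ≡ at xs m
  at-valsIn-rank (x ∷ xs) {zero}  _        x∈ rewrite valsIn-∷-in xs x∈ = refl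
  at-valsIn-rank (x ∷ xs) {suc m} (s≤s m<) m∈ with inRange? x
  ... | yes x∈ rewrite valsIn-∷-in xs x∈ | rank-∷-in xs m x∈ = at-valsIn-rank xs m< m∈
  ... | no  x∉ rewrite valsIn-∷-out xs x∉ | rank-∷-out xs m x∉ = at-valsIn-rank xs m< m∈

  at-replaceIn-in : ∀ qs xs {m} → length (valsIn a b xs) ≤ length qs →
    m < length xs → InRange (at xs m) →
    at (replaceIn a b qs xs) m ≡ at qs (rank xs m)
  at-replaceIn-in []       xs       vs≤ m< m∈ =
    ⊥-elim (n≮0 (<-≤-trans (rank<length-valsIn xs m< m∈) vs≤))
  at-replaceIn-in (q ∷ qs) (x ∷ xs) {zero} _ _ x∈ with inRange? x
  ... | yes _  = refl
  ... | no  x∉ = ⊥-elim (x∉ x∈)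
  at-replaceIn-in (q ∷ qs) (x ∷ xs) {suc m} vs≤ (s≤s m<) m∈ with inRange? x
  ... | yes x∈ rewrite valsIn-∷-in xs x∈ | rank-∷-in xs m x∈ = at-replaceIn-in qs xs (≤-pred vs≤) m< m∈
  ... | no  x∉ rewrite valsIn-∷-out xs x∉ | rank-∷-out xs m x∉ = at-replaceIn-in (q ∷ qs) xs vs≤ m< m∈

  at-replaceIn-out : ∀ qs xs {m} → m < length xs → ¬ InRange (at xs m) →
    at (replaceIn a b qs xs) m ≡ at xs m
  at-replaceIn-out qs (x ∷ xs) {m} m< m∉ with inRange? x | qs | m | m<
  ... | yes x∈ | _      | zero  | _       = ⊥-elim (m∉ x∈)
  ... | yes _  | []     | suc m | s≤s m< = at-replaceIn-out [] xs m< m∉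
  ... | yes _  | q ∷ qs | suc m | s≤s m< = at-replaceIn-out qs xs m< m∉
  ... | no  _  | []     | zero  | _       = refl
  ... | no  _  | q ∷ qs | zero  | _       = refl
  ... | no  _  | []     | suc m | s≤s m< = at-replaceIn-out [] xs m< m∉
  ... | no  _  | q ∷ qs | suc m | s≤s m< = at-replaceIn-out (q ∷ qs) xs m< m∉

  rank-step : ∀ xs j → rank xs (suc j) ≡ rank xs j
                      ⊎ (j < length xs × InRange (at xs j) × rank xs (suc j) ≡ suc (rank xs j))
  rank-step []       zero    = inj₁ refl
  rank-step []       (suc j) = inj₁ refl
  rank-step (x ∷ xs) zero    with inRange? x
  ... | yes x∈ = inj₂ (z<s , x∈ , rank-∷-in xs 0 x∈)
  ... | no  x∉ = inj₁ (rank-∷-out xs 0 x∉)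
  rank-step (x ∷ xs) (suc j) with inRange? x
  ... | yes x∈ rewrite rank-∷-in xs j x∈ | rank-∷-in xs (suc j) x∈ =
    Sum.map (cong suc) (λ (j< , j∈ , step) → s≤s j< , j∈ , cong suc step) (rank-step xs j)
  ... | no  x∉ rewrite rank-∷-out xs j x∉ | rank-∷-out xs (suc j) x∉ =
    Sum.map₂ (λ (j< , j∈ , step) → s≤s j< , j∈ , step) (rank-step xs j)

  rank-surjective : ∀ xs i j {t} → rank xs i ≤ t → t < rank xs j →
    Σ[ m ∈ ℕ ] i ≤ m × m < j × m < length xs × InRange (at xs m) × rank xs m ≡ t
  rank-surjective xs i (suc j) {t} i≤t t< with t <? rank xs j
  ... | yes t<j =
    let m , i≤m , m<j , rest = rank-surjective xs i j i≤t t<j in m , i≤m , m<n⇒m<1+n m<j , rest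
  ... | no t≮j with rank-step xs j
  ...   | inj₁ same = ⊥-elim (t≮j (subst (t <_) same t<))
  ...   | inj₂ (j< , j∈ , step) =
    j , ≮⇒≥ (λ j<i → <⇒≱ t< (≤-trans (rank-mono xs j<i) i≤t)) , ≤-refl , j< , j∈ ,
    ≤-antisym (≮⇒≥ t≮j) (≤-pred (subst (t <_) step t<))

  rank-injective : ∀ xs {m m'} → m < length xs → m' < length xs →
    InRange (at xs m) → InRange (at xs m') → rank xs m ≡ rank xs m' → m ≡ m'
  rank-injective xs {m} {m'} m< m'< m∈ m'∈ same with <-cmp m m'
  ... | tri< m<m' _ _ = ⊥-elim (<⇒≢ (rank-strict xs m<m' m< m∈) same)
  ... | tri≈ _ m≡m' _ = m≡m'
  ... | tri> _ _ m'<m = ⊥-elim (<⇒≢ (rank-strict xs m'<m m'< m'∈) (sym same))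

  ArgmaxOn-valsIn : ∀ xs {i j p} → p < length xs → InRange (at xs p) → ArgmaxOn xs i j p →
    ArgmaxOn (valsIn a b xs) (rank xs i) (rank xs j) (rank xs p)
  ArgmaxOn-valsIn xs {i} {j} p< p∈ max t i≤t t<j t≢p
    with m , i≤m , m<j , m< , m∈ , refl ← rank-surjective xs i j i≤t t<j =
    subst₂ _<_ (sym (at-valsIn-rank xs m< m∈)) (sym (at-valsIn-rank xs p< p∈))
      (max m i≤m m<j (t≢p ∘ cong (rank xs)))

  IsArgmax-valsIn : ∀ xs {r} → IsArgmax xs r → InRange (at xs r) → IsArgmax (valsIn a b xs) (rank xs r)
  IsArgmax-valsIn xs {r} (r< , max) r∈ =
    rank<length-valsIn xs r< r∈ ,
    subst (λ L → ArgmaxOn (valsIn a b xs) 0 L (rank xs r)) (rank-length xs) (ArgmaxOn-valsIn xs r< r∈ max)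

  below-range : ∀ {x y} → ¬ InRange x → x < y → InRange y → x < a
  below-range {x} x∉ x<y (_ , y≤b) with a ≤? x
  ... | yes a≤x = ⊥-elim (x∉ (a≤x , ≤-trans (<⇒≤ x<y) y≤b))
  ... | no  a≰x = ≰⇒> a≰x

  above-range : ∀ {x y} → ¬ InRange y → x < y → InRange x → b < y
  above-range {y = y} y∉ x<y (a≤x , _) with y ≤? b
  ... | yes y≤b = ⊥-elim (y∉ (≤-trans a≤x (<⇒≤ x<y) , y≤b))
  ... | no  y≰b = ≰⇒> y≰b

  ⊑-replaceIn : ∀ xs {qs} → All InRange qs → valsIn a b xs ⊑ qs → xs ⊑ replaceIn a b qs xs
  ⊑-replaceIn xs {qs} qs∈ vs⊑qs = record
    { length≡ = sym (length-replaceIn qs xs) ; argmax = argmax-replaced }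
    where
    at-in : ∀ {m} → m < length xs → InRange (at xs m) → at (replaceIn a b qs xs) m ≡ at qs (rank xs m)
    at-in = at-replaceIn-in qs xs (≤-reflexive (length≡ vs⊑qs))
    at-out : ∀ {m} → m < length xs → ¬ InRange (at xs m) → at (replaceIn a b qs xs) m ≡ at xs m
    at-out = at-replaceIn-out qs xs
    InRange-at-rank : ∀ {m} → m < length xs → InRange (at xs m) → InRange (at qs (rank xs m))
    InRange-at-rank m< m∈ = All-at qs∈ (subst (_ <_) (length≡ vs⊑qs) (rank<length-valsIn xs m< m∈))

    argmax-replaced : ∀ i j p → i ≤ p → p < j → j ≤ length xs → ArgmaxOn xs i j p →
      ArgmaxOn (replaceIn a b qs xs) i j p
    argmax-replaced i j p i≤p p<j j≤ max m i≤m m<j m≢p =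
      by-cases (<-≤-trans p<j j≤) (<-≤-trans m<j j≤) (inRange? (at xs p)) (inRange? (at xs m))
      where
      m<p : at xs m < at xs p
      m<p = max m i≤m m<j m≢p
      by-cases : p < length xs → m < length xs → Dec (InRange (at xs p)) → Dec (InRange (at xs m)) →
        at (replaceIn a b qs xs) m < at (replaceIn a b qs xs) p
      by-cases p< m< (yes p∈) (yes m∈) =
        subst₂ _<_ (sym (at-in m< m∈)) (sym (at-in p< p∈))
          (argmax vs⊑qs (rank xs i) (rank xs j) (rank xs p) (rank-mono xs i≤p) (rank-strict xs p<j p< p∈)
             (rank≤length-valsIn xs j) (ArgmaxOn-valsIn xs p< p∈ max)
             (rank xs m) (rank-mono xs i≤m) (rank-strict xs m<j m< m∈)
             (m≢p ∘ rank-injective xs m< p< m∈ p∈))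
      by-cases p< m< (yes p∈) (no m∉) =
        subst₂ _<_ (sym (at-out m< m∉)) (sym (at-in p< p∈))
          (<-≤-trans (below-range m∉ m<p p∈) (proj₁ (InRange-at-rank p< p∈)))
      by-cases p< m< (no p∉) (yes m∈) =
        subst₂ _<_ (sym (at-in m< m∈)) (sym (at-out p< p∉))
          (≤-<-trans (proj₂ (InRange-at-rank m< m∈)) (above-range p∉ m<p m∈))
      by-cases p< m< (no p∉) (no m∉) =
        subst₂ _<_ (sym (at-out m< m∉)) (sym (at-out p< p∉)) m<p

  MaxIsLength-replaceIn : ∀ xs {qs} → Distinct xs → MaxIsLength xs → b ≤ length xs →
    All InRange qs → valsIn a b xs ⊑ qs → MaxIs b qs → MaxIsLength (replaceIn a b qs xs)
  MaxIsLength-replaceIn []           _ _ _ _ _ _ _ (() , _)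
  MaxIsLength-replaceIn xs@(_ ∷ _) {qs} distinct xs-max b≤ qs∈ vs⊑qs qs-max r' argmax'
    with r , argmax ← IsArgmax-exists xs distinct z<s
    with refl ← IsArgmax-unique (replaceIn a b qs xs)
                  (⊑-IsArgmax (⊑-replaceIn xs qs∈ vs⊑qs) argmax) argmax'
    with inRange? (at xs r)
  ... | no r∉ =
    trans (at-replaceIn-out qs xs r< r∉) (trans (xs-max r argmax) (sym (length-replaceIn qs xs)))
    where r< = proj₁ argmax
  ... | yes r∈ =
    begin
      at (replaceIn a b qs xs) r  ≡⟨ at-replaceIn-in qs xs (≤-reflexive (length≡ vs⊑qs)) r< r∈ ⟩
      at qs (rank xs r)            ≡⟨ qs-max (rank xs r) (⊑-IsArgmax vs⊑qs (IsArgmax-valsIn xs argmax r∈)) ⟩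
      b                            ≡⟨ ≤-antisym b≤ (subst (_≤ b) (xs-max r argmax) (proj₂ r∈)) ⟩
      length xs                    ≡⟨ length-replaceIn qs xs ⟨
      length (replaceIn a b qs xs) ∎
    where open ≡-Reasoning
          r< = proj₁ argmax

-- Permutations of [1, n]

Unique⇒Distinct : ∀ xs → Unique xs → Distinct xs
Unique⇒Distinct (x ∷ xs) (x∉ ∷ u) zero    zero    _        _        _  = refl
Unique⇒Distinct (x ∷ xs) (x∉ ∷ u) zero    (suc j) _        (s≤s j<) eq = ⊥-elim (All-at x∉ j< eq)
Unique⇒Distinct (x ∷ xs) (x∉ ∷ u) (suc i) zero    (s≤s i<) _        eq = ⊥-elim (All-at x∉ i< (sym eq))
Unique⇒Distinct (x ∷ xs) (x∉ ∷ u) (suc i) (suc j) (s≤s i<) (s≤s j<) eq =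
  cong suc (Unique⇒Distinct xs u i j i< j< eq)

n∈applyUpTo-suc : ∀ {n} → 0 < n → n ∈ applyUpTo suc n
n∈applyUpTo-suc {suc n} _ = ∈-applyUpTo⁺ suc (n<1+n n)

module _ {n τ} (perm : IsPerm n τ) where
  IsPerm⇒↭applyUpTo : τ ↭ applyUpTo suc n
  IsPerm⇒↭applyUpTo = ↭-trans perm (↭-reflexive (map-upTo suc n))

  private
    perm′ = IsPerm⇒↭applyUpTo

  IsPerm⇒length : length τ ≡ n
  IsPerm⇒length = trans (↭-length perm′) (length-applyUpTo suc n)

  IsPerm⇒Unique : Unique τ
  IsPerm⇒Unique = Unique-resp-↭ (↭⇒↭ₛ (↭-sym perm′))
    (Unique.applyUpTo⁺₁ suc n (λ i<j _ → <⇒≢ i<j ∘ suc-injective))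

  IsPerm⇒Distinct : Distinct τ
  IsPerm⇒Distinct = Unique⇒Distinct τ IsPerm⇒Unique

  IsPerm⇒bounded : ∀ {m} → m < length τ → at τ m ≤ n
  IsPerm⇒bounded m< with i , i< , eq ← ∈-applyUpTo⁻ suc (∈-resp-↭ perm′ (at-∈ τ m<)) =
    subst (_≤ n) (sym eq) i<

  IsPerm⇒MaxIsLength : MaxIsLength τ
  IsPerm⇒MaxIsLength r (r< , max)
    with r₀ , r₀< , at≡n ←
           ∈-at τ (∈-resp-↭ (↭-sym perm′) (n∈applyUpTo-suc (subst (0 <_) IsPerm⇒length (≤-<-trans z≤n r<))))
    with r₀ ≟ r
  ... | yes refl = trans at≡n (sym IsPerm⇒length)
  ... | no r₀≢r  =
    ⊥-elim (<⇒≱ (max r₀ z≤n r₀< r₀≢r) (subst (at τ r ≤_) (sym at≡n) (IsPerm⇒bounded r<)))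

applyUpTo-+ : ∀ (f : ℕ → ℕ) m k → applyUpTo f (m + k) ≡ applyUpTo f m ++ applyUpTo (f ∘ (m +_)) k
applyUpTo-+ f zero    k = refl
applyUpTo-+ f (suc m) k = cong (f 0 ∷_) (applyUpTo-+ (f ∘ suc) m k)

valsIn-applyUpTo-suc : ∀ a' k l →
  valsIn (suc a') (a' + k) (applyUpTo suc (a' + (k + l))) ≡ applyUpTo (suc ∘ (a' +_)) k
valsIn-applyUpTo-suc a' k l =
  begin
    filter inRange? (applyUpTo suc (a' + (k + l)))
  ≡⟨ cong (filter inRange?) (applyUpTo-+ suc a' (k + l)) ⟩
    filter inRange? (applyUpTo suc a' ++ applyUpTo (suc ∘ (a' +_)) (k + l))
  ≡⟨ filter-++ inRange? (applyUpTo suc a') _ ⟩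
    filter inRange? (applyUpTo suc a') ++ filter inRange? (applyUpTo (suc ∘ (a' +_)) (k + l))
  ≡⟨ cong₂ (λ xs ys → xs ++ filter inRange? ys) (filter-none inRange? below) (applyUpTo-+ _ k l) ⟩
    filter inRange? (applyUpTo (suc ∘ (a' +_)) k ++ applyUpTo (suc ∘ (a' +_) ∘ (k +_)) l)
  ≡⟨ filter-++ inRange? (applyUpTo (suc ∘ (a' +_)) k) _ ⟩
    filter inRange? (applyUpTo (suc ∘ (a' +_)) k) ++ filter inRange? (applyUpTo (suc ∘ (a' +_) ∘ (k +_)) l)
  ≡⟨ cong₂ _++_ (filter-all inRange? inside) (filter-none inRange? above) ⟩
    applyUpTo (suc ∘ (a' +_)) k ++ []
  ≡⟨ ++-identityʳ _ ⟩
    applyUpTo (suc ∘ (a' +_)) k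
  ∎
  where
  open ≡-Reasoning
  open Replacement (suc a') (a' + k)
  below : All (¬_ ∘ InRange) (applyUpTo suc a')
  below = All.applyUpTo⁺₁ suc a' λ i<a' (a'<i , _) → <⇒≱ i<a' (≤-pred a'<i)
  inside : All InRange (applyUpTo (suc ∘ (a' +_)) k)
  inside = All.applyUpTo⁺₁ _ k λ {i} i<k →
    s≤s (m≤m+n a' i) , subst (_≤ a' + k) (+-suc a' i) (+-monoʳ-≤ a' i<k)
  above : All (¬_ ∘ InRange) (applyUpTo (suc ∘ (a' +_) ∘ (k +_)) l)
  above = All.applyUpTo⁺₁ _ l λ {i} _ (_ , ≤b) → <⇒≱ (s≤s (+-monoʳ-≤ a' (m≤m+n k i))) ≤b

a'+length-valsIn : ∀ {n τ} a' {b} → IsPerm n τ → a' ≤ b → b ≤ n → a' + length (valsIn (suc a') b τ) ≡ b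
a'+length-valsIn {τ = τ} a' perm a'≤b b≤n
  with k , refl ← m≤n⇒∃[o]m+o≡n a'≤b
  with l , refl ← m≤n⇒∃[o]m+o≡n b≤n =
  cong (a' +_) (begin
    length (valsIn (suc a') (a' + k) τ)
  ≡⟨ ↭-length (filter-↭ inRange? (IsPerm⇒↭applyUpTo perm)) ⟩
    length (valsIn (suc a') (a' + k) (applyUpTo suc (a' + k + l)))
  ≡⟨ cong (length ∘ valsIn (suc a') (a' + k) ∘ applyUpTo suc) (+-assoc a' k l) ⟩
    length (valsIn (suc a') (a' + k) (applyUpTo suc (a' + (k + l))))
  ≡⟨ cong length (valsIn-applyUpTo-suc a' k l) ⟩
    length (applyUpTo (suc ∘ (a' +_)) k)
  ≡⟨ length-applyUpTo _ k ⟩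
    k
  ∎)
  where
  open ≡-Reasoning
  open Replacement (suc a') (a' + k)

lemma6p2 : (n : ℕ) (τ : List ℕ) → IsPerm n τ → (a b : ℕ) → 1 ≤ a → a < b → b ≤ n →
    lam τ ≡ lam (tauBar a b τ)
lemma6p2 n τ perm zero     b () _   _
lemma6p2 n τ perm (suc a') b _  a<b b≤n =
  lamF-resp-⊑ (length τ) (length τ̄) ≤-refl ≤-refl distinct-τ τ-max τ̄-max
    (⊑-replaceIn τ in-range vs⊑qs)
  where
  open Replacement (suc a') b
  vs = valsIn (suc a') b τ
  qs = relabel a' vs
  τ̄ = replaceIn (suc a') b qs τ
  distinct-τ = IsPerm⇒Distinct perm
  τ-max = IsPerm⇒MaxIsLength perm
  a'+|vs|≡b : a' + length vs ≡ b
  a'+|vs|≡b = a'+length-valsIn a' perm (≤-trans (n≤1+n a') (<⇒≤ a<b)) b≤n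
  distinct-vs : Distinct vs
  distinct-vs = Unique⇒Distinct vs (Unique.filter⁺ inRange? (IsPerm⇒Unique perm))
  vs⊑qs : vs ⊑ qs
  vs⊑qs = ⊑-relabel a' vs distinct-vs
  in-range : All InRange qs
  in-range = All.map (λ (a'<v , v≤) → a'<v , subst (_ ≤_) a'+|vs|≡b v≤)
               (relabel-bounded a' vs distinct-vs)
  τ̄-max : MaxIsLength τ̄
  τ̄-max = MaxIsLength-replaceIn τ distinct-τ τ-max (subst (b ≤_) (sym (IsPerm⇒length perm)) b≤n)
            in-range vs⊑qs (subst (λ v → MaxIs v qs) a'+|vs|≡b (MaxIs-relabel a' vs distinct-vs))
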